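{- In $\mu\mathrm{NJ}$ modulo $\equiv$, term-level substitution preserves type assignment: if $\Gamma\vdash_\equiv\pi:P$ then $\Gamma\theta\vdash_\equiv\pi\theta:P\theta$ for every term substitution $\theta$.
   Context: Formulas over simply typed $\lambda$-terms modulo $\beta\eta$: $P ::= \top \mid \bot \mid P\supset Q \mid P\wedge Q \mid P\vee Q \mid \forall x.P \mid \exists x.P \mid t=t' \mid \mu B\vec t \mid \nu B\vec t \mid p\vec t \mid a\vec t$, $B=\lambda p\lambda\vec x.P$ with $p$ positive in $P$. $\equiv$ is a fixed congruence (containing $\beta\eta$, closed under substitution). $\mathrm{csu}(u,v)$: a set of unifiers $\theta_i$ ($u\theta_i\equiv v\theta_i$) such that every unifier is some $\theta_i\theta'$. Proof terms: $\alpha$, $\langle\rangle$, $\delta_\bot(\pi)$, $\lambda\alpha.\pi$, $\pi\pi'$, $\langle\pi,\pi'\rangle$, $\mathrm{proj}_i(\pi)$, $\mathrm{in}_i(\pi)$, $\delta_\vee(\pi,\alpha.\pi_1,\beta.\pi_2)$, $\lambda x.\pi$, $\pi t$, $\langle t,\pi\rangle$, $\delta_\exists(\pi,x.\alpha.\pi')$, $\mathrm{refl}(t)$, $\delta_=(\Gamma,\theta,\sigma,u,v,Q,\pi;(\theta'_i.\pi_i)_i)$, $\mu(B,\vec t,\pi)$, $\delta_\mu(\pi,\vec x.\alpha.\pi')$, $\nu(\pi,\vec x.\alpha.\pi')$, $\delta_\nu(B,\vec t,\pi)$. Typing (bound variables fresh; $\Gamma'\vdash\sigma:\Gamma$ means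 $\Gamma'\vdash\sigma(\alpha):\Gamma(\alpha)$ on the common domain): $\alpha:P$ if $(\alpha:Q)\in\Gamma$, $P\equiv Q$; $\langle\rangle:P$ if $P\equiv\top$; $\delta_\bot(\pi):P$ from $\pi:\bot$; $\lambda\alpha.\pi:P$ from $\Gamma,\alpha:P_1\vdash\pi:P_2$, $P\equiv P_1\supset P_2$; $\pi\pi':P$ from $\pi:Q\supset P$, $\pi':Q$; $\langle\pi_1,\pi_2\rangle:P$ from $\pi_j:P_j$, $P\equiv P_1\wedge P_2$; $\mathrm{proj}_i(\pi):P'$ from $\pi:P_1\wedge P_2$, $P'\equiv P_i$; $\mathrm{in}_i(\pi):P$ from $\pi:P_i$, $P\equiv P_1\vee P_2$; $\delta_\vee(\pi,\alpha.\pi_1,\beta.\pi_2):P$ from $\pi:P_1\vee P_2$, $\Gamma,\alpha:P_1\vdash\pi_1:P$, $\Gamma,\beta:P_2\vdash\pi_2:P$; $\lambda x.\pi:P$ from $\pi:Q$, $P\equiv\forall x.Q$; $\pi t:P$ from $\pi:\forall x.Q$, $P\equiv Q[t/x]$; $\langle t,\pi\rangle:P$ from $\pi:Q[t/x]$, $P\equiv\exists x.Q$; $\delta_\exists(\pi,x.\alpha.\pi'):P$ from $\pi:\exists x.Q$, $\Gamma,\alpha:Q\vdash\pi':P$; $\mathrm{refl}(t):P$ if $P\equiv(t=t)$; $\Gamma'\vdash\delta_=(\Gamma,\theta,\sigma,u,v,Q,\pi;(\theta'_i.\pi_i)_i):P$ from $\Gamma'\vdash\pi:u\theta=v\theta$,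 $\Gamma'\vdash\sigma:\Gamma\theta$, $\Gamma\theta'_i\vdash\pi_i:Q\theta'_i$ for all $i$, $(\theta'_i)_i$ a $\mathrm{csu}(u,v)$, $P\equiv Q\theta$; $\mu(B,\vec t,\pi):P$ from $\pi:B(\mu B)\vec t$, $P\equiv\mu B\vec t$; $\delta_\mu(\pi,\vec x.\alpha.\pi'):P$ from $\pi:\mu B\vec t$, $\Gamma,\alpha:BS\vec x\vdash\pi':S\vec x$, $P\equiv S\vec t$; $\nu(\pi,\vec x.\alpha.\pi'):P$ from $\pi:S\vec t$, $\Gamma,\alpha:S\vec x\vdash\pi':BS\vec x$, $P\equiv\nu B\vec t$; $\delta_\nu(B,\vec t,\pi):P$ from $\pi:\nu B\vec t$, $P\equiv B(\nu B)\vec t$. Term substitution $\pi\theta$ is capture-avoiding and homomorphic, except $\delta_=(\Gamma,\theta',\sigma,u,v,Q,\pi;(\theta''_i.\pi_i)_i)\theta=\delta_=(\Gamma,\theta'\theta,\sigma\theta,u,v,Q,\pi\theta;(\theta''_i.\pi_i)_i)$ (with $\sigma\theta$ applying $\theta$ to each proof in $\sigma$); $\mu(B,\vec t,\pi)\theta=\mu(B\theta,\vec t\theta,\pi\theta)$, $\delta_\nu(B,\vec t,\pi)\theta=\delta_\nu(B\theta,\vec t\theta,\pi\theta)$. -}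

module Defs where

open import Data.Bool using (Bool; true; false; not)
open import Level using (Level)
open import Data.Nat using (ℕ; zero; suc)
open import Data.List using (List; []; _∷_; _++_; map)
open import Data.List.Properties using (map-++)
open import Data.Maybe using (Maybe; just; nothing)
open import Data.Product using (Σ; _×_; _,_)
open import Data.Sum using (_⊎_; inj₁; inj₂)
open import Relation.Binary.PropositionalEquality using (_≡_; refl; sym; trans; cong; subst)
open import Relation.Binary.Structures using (IsEquivalence)

infix 4 _∋_
data _∋_ {A : Set} : List A → A → Set where
  here  : ∀ {x xs} → (x ∷ xs) ∋ x
  there : ∀ {x y xs} → xs ∋ x → (y ∷ xs) ∋ x

∋-++ˡ : ∀ {A : Set} {xs : List A} (ys : List A) {x : A} → xs ∋ x → (xs ++ ys) ∋ x
∋-++ˡ ys here      = here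
∋-++ˡ ys (there p) = there (∋-++ˡ ys p)

∋-snoc : ∀ {A : Set} (xs : List A) {y x : A} → (xs ++ y ∷ []) ∋ x → (xs ∋ x) ⊎ (x ≡ y)
∋-snoc []       here      = inj₂ refl
∋-snoc []       (there ())
∋-snoc (z ∷ xs) here      = inj₁ here
∋-snoc (z ∷ xs) (there p) with ∋-snoc xs p
... | inj₁ q = inj₁ (there q)
... | inj₂ e = inj₂ e

-- partial lookup (proof variables are de Bruijn indices into a list)
_!!_ : ∀ {a} {A : Set a} → List A → ℕ → Maybe A
[]       !! n     = nothing
(x ∷ xs) !! zero  = just x
(x ∷ xs) !! suc n = xs !! n

data Ty (B : Set) : Set where
  base : B → Ty B
  _⇒_  : Ty B → Ty B → Ty B

record Sig : Set₁ where
  field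
    Base : Set
    Con  : Ty Base → Set
    PCon : List (Ty Base) → Set

module Syntax (Sg : Sig) where
  open Sig Sg

  Type  = Ty Base
  Ctx   = List Type
  Arity = List Type

  data Tm (Δ : Ctx) : Type → Set where
    var : ∀ {τ} → Δ ∋ τ → Tm Δ τ
    con : ∀ {τ} → Con τ → Tm Δ τ
    lam : ∀ {σ τ} → Tm (σ ∷ Δ) τ → Tm Δ (σ ⇒ τ)
    app : ∀ {σ τ} → Tm Δ (σ ⇒ τ) → Tm Δ σ → Tm Δ τ

  data Tms (Δ : Ctx) : Arity → Set where
    []  : Tms Δ []
    _∷_ : ∀ {τ ar} → Tm Δ τ → Tms Δ ar → Tms Δ (τ ∷ ar)

  Ren Sub : Ctx → Ctx → Set
  Ren Δ Δ' = ∀ {τ} → Δ ∋ τ → Δ' ∋ τ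
  Sub Δ Δ' = ∀ {τ} → Δ ∋ τ → Tm Δ' τ

  liftR : ∀ {Δ Δ' σ} → Ren Δ Δ' → Ren (σ ∷ Δ) (σ ∷ Δ')
  liftR ρ here      = here
  liftR ρ (there x) = there (ρ x)

  ren : ∀ {Δ Δ' τ} → Ren Δ Δ' → Tm Δ τ → Tm Δ' τ
  ren ρ (var x)   = var (ρ x)
  ren ρ (con c)   = con c
  ren ρ (lam t)   = lam (ren (liftR ρ) t)
  ren ρ (app t u) = app (ren ρ t) (ren ρ u)

  liftS : ∀ {Δ Δ' σ} → Sub Δ Δ' → Sub (σ ∷ Δ) (σ ∷ Δ')
  liftS θ here      = var here
  liftS θ (there x) = ren there (θ x)

  sub : ∀ {Δ Δ' τ} → Sub Δ Δ' → Tm Δ τ → Tm Δ' τ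
  sub θ (var x)   = θ x
  sub θ (con c)   = con c
  sub θ (lam t)   = lam (sub (liftS θ) t)
  sub θ (app t u) = app (sub θ t) (sub θ u)

  subs : ∀ {Δ Δ' ar} → Sub Δ Δ' → Tms Δ ar → Tms Δ' ar
  subs θ []       = []
  subs θ (t ∷ ts) = sub θ t ∷ subs θ ts

  rens : ∀ {Δ Δ' ar} → Ren Δ Δ' → Tms Δ ar → Tms Δ' ar
  rens ρ []       = []
  rens ρ (t ∷ ts) = ren ρ t ∷ rens ρ ts

  -- composition: (θ ⨾ η) x = (θ x) η, i.e. the substitution "θη"
  _⨾_ : ∀ {Δ₁ Δ₂ Δ₃} → Sub Δ₁ Δ₂ → Sub Δ₂ Δ₃ → Sub Δ₁ Δ₃
  (θ ⨾ η) x = sub η (θ x)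

  wkN : ∀ {Δ} (ar : Arity) → Ren Δ (ar ++ Δ)
  wkN []       x = x
  wkN (τ ∷ ar) x = there (wkN ar x)

  wkS : ∀ {Δ} (ar : Arity) → Sub Δ (ar ++ Δ)
  wkS ar x = var (wkN ar x)

  liftSN : ∀ {Δ Δ'} (ar : Arity) → Sub Δ Δ' → Sub (ar ++ Δ) (ar ++ Δ')
  liftSN []       θ = θ
  liftSN (τ ∷ ar) θ = liftS (liftSN ar θ)

  _,,_ : ∀ {Δ Δ' ar} → Tms Δ' ar → Sub Δ Δ' → Sub (ar ++ Δ) Δ'
  ([]       ,, θ) x         = θ x
  ((t ∷ ts) ,, θ) here      = t
  ((t ∷ ts) ,, θ) (there x) = (ts ,, θ) x

  vars : ∀ {Δ} (ar : Arity) → Tms (ar ++ Δ) ar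
  vars []       = []
  vars (τ ∷ ar) = var here ∷ rens there (vars ar)

  -- A predicate-variable context records, for each bound
  -- predicate variable p, its arity and its *current* polarity
  -- (true = positive).  The left of ⊃ flips all polarities; an atom
  -- p t⃗ is only allowed when p is currently positive.  Hence in
  -- μ/ν (λp λx⃗. P) the variable p occurs only positively in P.

  PCtx = List (Arity × Bool)

  flipE : Arity × Bool → Arity × Bool
  flipE (ar , b) = ar , not b

  flipP : PCtx → PCtx
  flipP = map flipE

  infixr 5 _⊃_
  data Fm : PCtx → Ctx → Set where
    ⊤'   : ∀ {Ψ Δ} → Fm Ψ Δ
    ⊥'   : ∀ {Ψ Δ} → Fm Ψ Δ
    _⊃_  : ∀ {Ψ Δ} → Fm (flipP Ψ) Δ → Fm Ψ Δ → Fm Ψ Δ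
    _∧'_ : ∀ {Ψ Δ} → Fm Ψ Δ → Fm Ψ Δ → Fm Ψ Δ
    _∨'_ : ∀ {Ψ Δ} → Fm Ψ Δ → Fm Ψ Δ → Fm Ψ Δ
    ∀'   : ∀ {Ψ Δ} (τ : Type) → Fm Ψ (τ ∷ Δ) → Fm Ψ Δ
    ∃'   : ∀ {Ψ Δ} (τ : Type) → Fm Ψ (τ ∷ Δ) → Fm Ψ Δ
    eq   : ∀ {Ψ Δ τ} → Tm Δ τ → Tm Δ τ → Fm Ψ Δ
    -- μ B t⃗ and ν B t⃗ with B = λp λx⃗. P  (P : Fm ((ar,+) ∷ Ψ) (ar ++ Δ))
    μ'   : ∀ {Ψ Δ} (ar : Arity) → Fm ((ar , true) ∷ Ψ) (ar ++ Δ) → Tms Δ ar → Fm Ψ Δ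
    ν'   : ∀ {Ψ Δ} (ar : Arity) → Fm ((ar , true) ∷ Ψ) (ar ++ Δ) → Tms Δ ar → Fm Ψ Δ
    pv   : ∀ {Ψ Δ ar} → Ψ ∋ (ar , true) → Tms Δ ar → Fm Ψ Δ
    pc   : ∀ {Ψ Δ ar} → PCon ar → Tms Δ ar → Fm Ψ Δ

  Formula : Ctx → Set
  Formula Δ = Fm [] Δ

  -- body of a fixed point operator B = λp λx⃗. P of arity ar, over Δ
  Op : Arity → Ctx → Set
  Op ar Δ = Fm ((ar , true) ∷ []) (ar ++ Δ)

  fsub : ∀ {Ψ Δ Δ'} → Sub Δ Δ' → Fm Ψ Δ → Fm Ψ Δ'
  fsub θ ⊤'         = ⊤'
  fsub θ ⊥'         = ⊥'
  fsub θ (A ⊃ C)    = fsub θ A ⊃ fsub θ C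
  fsub θ (A ∧' C)   = fsub θ A ∧' fsub θ C
  fsub θ (A ∨' C)   = fsub θ A ∨' fsub θ C
  fsub θ (∀' τ A)   = ∀' τ (fsub (liftS θ) A)
  fsub θ (∃' τ A)   = ∃' τ (fsub (liftS θ) A)
  fsub θ (eq t u)   = eq (sub θ t) (sub θ u)
  fsub θ (μ' ar B ts) = μ' ar (fsub (liftSN ar θ) B) (subs θ ts)
  fsub θ (ν' ar B ts) = ν' ar (fsub (liftSN ar θ) B) (subs θ ts)
  fsub θ (pv p ts)  = pv p (subs θ ts)
  fsub θ (pc a ts)  = pc a (subs θ ts)

  pweaken : ∀ {Φ Δ} (Ψ : PCtx) → Fm Φ Δ → Fm (Φ ++ Ψ) Δ
  pweaken Ψ ⊤'         = ⊤'
  pweaken Ψ ⊥'         = ⊥'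
  pweaken {Φ} {Δ} Ψ (A ⊃ C) =
    subst (λ X → Fm X Δ) (sym (map-++ flipE Φ Ψ)) (pweaken (flipP Ψ) A) ⊃ pweaken Ψ C
  pweaken Ψ (A ∧' C)   = pweaken Ψ A ∧' pweaken Ψ C
  pweaken Ψ (A ∨' C)   = pweaken Ψ A ∨' pweaken Ψ C
  pweaken Ψ (∀' τ A)   = ∀' τ (pweaken Ψ A)
  pweaken Ψ (∃' τ A)   = ∃' τ (pweaken Ψ A)
  pweaken Ψ (eq t u)   = eq t u
  pweaken Ψ (μ' ar B ts) = μ' ar (pweaken Ψ B) ts
  pweaken Ψ (ν' ar B ts) = ν' ar (pweaken Ψ B) ts
  pweaken Ψ (pv p ts)  = pv (∋-++ˡ Ψ p) ts
  pweaken Ψ (pc a ts)  = pc a ts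

  -- substitution of the predicate S = λx⃗. S (S : Fm [] (ar ++ Δ₀)) for
  -- the outermost-bound predicate variable (last in the context);
  -- ρ maps the free term variables Δ₀ of S into the current context Δ.
  -- An atom p u⃗ becomes S[u⃗/x⃗] (β-reduced application S u⃗).
  psub : ∀ {Ψ Δ Δ₀ ar b} (Φ : PCtx) → Ψ ≡ Φ ++ (ar , b) ∷ [] →
         Fm [] (ar ++ Δ₀) → Sub Δ₀ Δ → Fm Ψ Δ → Fm Φ Δ
  psub Φ e S ρ ⊤'       = ⊤'
  psub Φ e S ρ ⊥'       = ⊥'
  psub {ar = ar} {b} Φ e S ρ (A ⊃ C) =
    psub (flipP Φ) (trans (cong flipP e) (map-++ flipE Φ ((ar , b) ∷ []))) S ρ A
      ⊃ psub Φ e S ρ C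
  psub Φ e S ρ (A ∧' C) = psub Φ e S ρ A ∧' psub Φ e S ρ C
  psub Φ e S ρ (A ∨' C) = psub Φ e S ρ A ∨' psub Φ e S ρ C
  psub Φ e S ρ (∀' τ A) = ∀' τ (psub Φ e S (ρ ⨾ wkS (τ ∷ [])) A)
  psub Φ e S ρ (∃' τ A) = ∃' τ (psub Φ e S (ρ ⨾ wkS (τ ∷ [])) A)
  psub Φ e S ρ (eq t u) = eq t u
  psub Φ e S ρ (μ' ar' B ts) =
    μ' ar' (psub ((ar' , true) ∷ Φ) (cong ((ar' , true) ∷_) e) S (ρ ⨾ wkS ar') B) ts
  psub Φ e S ρ (ν' ar' B ts) =
    ν' ar' (psub ((ar' , true) ∷ Φ) (cong ((ar' , true) ∷_) e) S (ρ ⨾ wkS ar') B) ts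
  psub Φ e S ρ (pv p ts) with ∋-snoc Φ (subst (_∋ _) e p)
  ... | inj₁ q    = pv q ts
  ... | inj₂ refl = pweaken Φ (fsub (ts ,, ρ) S)
  psub Φ e S ρ (pc a ts) = pc a ts

  -- B S (as a predicate λx⃗. B S x⃗), for B an operator and S a predicate over Δ
  Bapp : ∀ {Δ ar} → Op ar Δ → Formula (ar ++ Δ) → Formula (ar ++ Δ)
  Bapp {Δ} {ar} B S = psub [] refl S (wkS ar) B

  papp : ∀ {Δ ar} → Formula (ar ++ Δ) → Tms Δ ar → Formula Δ
  papp S ts = fsub (ts ,, var) S

  -- μB and νB as predicates λx⃗. μ B x⃗
  μpred νpred : ∀ {Δ ar} → Op ar Δ → Formula (ar ++ Δ)
  μpred {Δ} {ar} B = μ' ar (fsub (liftSN ar (wkS ar)) B) (vars ar)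
  νpred {Δ} {ar} B = ν' ar (fsub (liftSN ar (wkS ar)) B) (vars ar)

  Pw : ∀ {Δ ar} → (∀ {τ} → Tm Δ τ → Tm Δ τ → Set) → Tms Δ ar → Tms Δ ar → Set
  Pw R []       []       = Data.Unit.⊤ where import Data.Unit
  Pw R (t ∷ ts) (u ∷ us) = R t u × Pw R ts us

  record Congruence : Set₁ where
    infix 4 _≈t_ _≈f_
    field
      _≈t_ : ∀ {Δ τ} → Tm Δ τ → Tm Δ τ → Set
      _≈f_ : ∀ {Ψ Δ} → Fm Ψ Δ → Fm Ψ Δ → Set
      ≈t-equiv : ∀ {Δ τ} → IsEquivalence (_≈t_ {Δ} {τ})
      ≈f-equiv : ∀ {Ψ Δ} → IsEquivalence (_≈f_ {Ψ} {Δ})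
      β : ∀ {Δ σ τ} (t : Tm (σ ∷ Δ) τ) (u : Tm Δ σ) →
          app (lam t) u ≈t sub ((u ∷ []) ,, var) t
      η : ∀ {Δ σ τ} (t : Tm Δ (σ ⇒ τ)) → lam (app (ren there t) (var here)) ≈t t
      lam-cong : ∀ {Δ σ τ} {t t' : Tm (σ ∷ Δ) τ} → t ≈t t' → lam t ≈t lam t'
      app-cong : ∀ {Δ σ τ} {t t' : Tm Δ (σ ⇒ τ)} {u u' : Tm Δ σ} →
                 t ≈t t' → u ≈t u' → app t u ≈t app t' u'
      ⊃-cong : ∀ {Ψ Δ} {A A' : Fm (flipP Ψ) Δ} {C C' : Fm Ψ Δ} →
               A ≈f A' → C ≈f C' → (A ⊃ C) ≈f (A' ⊃ C')
      ∧-cong : ∀ {Ψ Δ} {A A' C C' : Fm Ψ Δ} → A ≈f A' → C ≈f C' → (A ∧' C) ≈f (A' ∧' C')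
      ∨-cong : ∀ {Ψ Δ} {A A' C C' : Fm Ψ Δ} → A ≈f A' → C ≈f C' → (A ∨' C) ≈f (A' ∨' C')
      ∀-cong : ∀ {Ψ Δ τ} {A A' : Fm Ψ (τ ∷ Δ)} → A ≈f A' → ∀' τ A ≈f ∀' τ A'
      ∃-cong : ∀ {Ψ Δ τ} {A A' : Fm Ψ (τ ∷ Δ)} → A ≈f A' → ∃' τ A ≈f ∃' τ A'
      eq-cong : ∀ {Ψ Δ τ} {t t' u u' : Tm Δ τ} → t ≈t t' → u ≈t u' →
                eq {Ψ} t u ≈f eq t' u'
      μ-cong : ∀ {Ψ Δ ar} {B B' : Fm ((ar , true) ∷ Ψ) (ar ++ Δ)} {ts ts' : Tms Δ ar} →
               B ≈f B' → Pw _≈t_ ts ts' → μ' ar B ts ≈f μ' ar B' ts'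
      ν-cong : ∀ {Ψ Δ ar} {B B' : Fm ((ar , true) ∷ Ψ) (ar ++ Δ)} {ts ts' : Tms Δ ar} →
               B ≈f B' → Pw _≈t_ ts ts' → ν' ar B ts ≈f ν' ar B' ts'
      pv-cong : ∀ {Ψ Δ ar} {p : Ψ ∋ (ar , true)} {ts ts' : Tms Δ ar} →
                Pw _≈t_ ts ts' → pv p ts ≈f pv p ts'
      pc-cong : ∀ {Ψ Δ ar} {a : PCon ar} {ts ts' : Tms Δ ar} →
                Pw _≈t_ ts ts' → pc {Ψ} a ts ≈f pc a ts'
      ≈t-sub : ∀ {Δ Δ' τ} (θ : Sub Δ Δ') {t t' : Tm Δ τ} → t ≈t t' → sub θ t ≈t sub θ t'
      ≈f-sub : ∀ {Ψ Δ Δ'} (θ : Sub Δ Δ') {A A' : Fm Ψ Δ} → A ≈f A' → fsub θ A ≈f fsub θ A'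

  -- Proof terms (term variables de Bruijn and typed; proof variables are
  -- de Bruijn indices, a binder α pushes onto the hypothesis list).

  data Pf (Δ : Ctx) : Set₁ where
    hyp    : ℕ → Pf Δ
    unit   : Pf Δ
    δ⊥     : Pf Δ → Pf Δ
    ƛ      : Pf Δ → Pf Δ
    _·_    : Pf Δ → Pf Δ → Pf Δ
    pair   : Pf Δ → Pf Δ → Pf Δ
    proj₁' : Pf Δ → Pf Δ
    proj₂' : Pf Δ → Pf Δ
    in₁    : Pf Δ → Pf Δ
    in₂    : Pf Δ → Pf Δ
    δ∨     : Pf Δ → Pf Δ → Pf Δ → Pf Δ
    Λ      : (τ : Type) → Pf (τ ∷ Δ) → Pf Δ
    _·t_   : ∀ {τ} → Pf Δ → Tm Δ τ → Pf Δ
    ⟨_,_⟩t : ∀ {τ} → Tm Δ τ → Pf Δ → Pf Δ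
    δ∃     : Pf Δ → (τ : Type) → Pf (τ ∷ Δ) → Pf Δ
    reflP  : ∀ {τ} → Tm Δ τ → Pf Δ
    δ≡     : ∀ {τ} (Δ₀ : Ctx) (Γ : List (Formula Δ₀)) (θ : Sub Δ₀ Δ)
             (σ : List (Pf Δ)) (u v : Tm Δ₀ τ) (Q : Formula Δ₀) (π : Pf Δ)
             (I : Set) (Δs : I → Ctx) (θs : (i : I) → Sub Δ₀ (Δs i))
             (πs : (i : I) → Pf (Δs i)) → Pf Δ
    μI     : (ar : Arity) → Op ar Δ → Tms Δ ar → Pf Δ → Pf Δ
    δμ     : Pf Δ → (ar : Arity) → Pf (ar ++ Δ) → Pf Δ
    νI     : Pf Δ → (ar : Arity) → Pf (ar ++ Δ) → Pf Δ
    δν     : (ar : Arity) → Op ar Δ → Tms Δ ar → Pf Δ → Pf Δ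

  mutual
    pfsub : ∀ {Δ Δ'} → Sub Δ Δ' → Pf Δ → Pf Δ'
    pfsub θ (hyp n)       = hyp n
    pfsub θ unit          = unit
    pfsub θ (δ⊥ π)        = δ⊥ (pfsub θ π)
    pfsub θ (ƛ π)         = ƛ (pfsub θ π)
    pfsub θ (π · π')      = pfsub θ π · pfsub θ π'
    pfsub θ (pair π π')   = pair (pfsub θ π) (pfsub θ π')
    pfsub θ (proj₁' π)    = proj₁' (pfsub θ π)
    pfsub θ (proj₂' π)    = proj₂' (pfsub θ π)
    pfsub θ (in₁ π)       = in₁ (pfsub θ π)
    pfsub θ (in₂ π)       = in₂ (pfsub θ π)
    pfsub θ (δ∨ π π₁ π₂)  = δ∨ (pfsub θ π) (pfsub θ π₁) (pfsub θ π₂)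
    pfsub θ (Λ τ π)       = Λ τ (pfsub (liftS θ) π)
    pfsub θ (π ·t t)      = pfsub θ π ·t sub θ t
    pfsub θ ⟨ t , π ⟩t    = ⟨ sub θ t , pfsub θ π ⟩t
    pfsub θ (δ∃ π τ π')   = δ∃ (pfsub θ π) τ (pfsub (liftS θ) π')
    pfsub θ (reflP t)     = reflP (sub θ t)
    pfsub θ (δ≡ Δ₀ Γ θ' σ u v Q π I Δs θs πs) =
      δ≡ Δ₀ Γ (θ' ⨾ θ) (pfsubs θ σ) u v Q (pfsub θ π) I Δs θs πs
    pfsub θ (μI ar B ts π) = μI ar (fsub (liftSN ar θ) B) (subs θ ts) (pfsub θ π)
    pfsub θ (δμ π ar π')  = δμ (pfsub θ π) ar (pfsub (liftSN ar θ) π')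
    pfsub θ (νI π ar π')  = νI (pfsub θ π) ar (pfsub (liftSN ar θ) π')
    pfsub θ (δν ar B ts π) = δν ar (fsub (liftSN ar θ) B) (subs θ ts) (pfsub θ π)

    pfsubs : ∀ {Δ Δ'} → Sub Δ Δ' → List (Pf Δ) → List (Pf Δ')
    pfsubs θ []       = []
    pfsubs θ (π ∷ σ)  = pfsub θ π ∷ pfsubs θ σ

  ctxsub : ∀ {Δ Δ'} → Sub Δ Δ' → List (Formula Δ) → List (Formula Δ')
  ctxsub θ Γ = map (fsub θ) Γ

module Typing (Sg : Sig) (E : Syntax.Congruence Sg) where
  open Syntax Sg
  open Syntax.Congruence E

  IsCSU : ∀ {Δ₀ τ} (u v : Tm Δ₀ τ) (I : Set) (Δs : I → Ctx)
          (θs : (i : I) → Sub Δ₀ (Δs i)) → Set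
  IsCSU {Δ₀} u v I Δs θs =
    ((i : I) → sub (θs i) u ≈t sub (θs i) v) ×
    (∀ (Δ'' : Ctx) (ρ : Sub Δ₀ Δ'') → sub ρ u ≈t sub ρ v →
       Σ I λ i → Σ (Sub (Δs i) Δ'') λ η →
         ∀ {τ'} (x : Δ₀ ∋ τ') → ρ x ≈t (θs i ⨾ η) x)

  wkΓ : ∀ {Δ} (ar : Arity) → List (Formula Δ) → List (Formula (ar ++ Δ))
  wkΓ ar Γ = ctxsub (wkS ar) Γ

  infix 3 _⊢_∶_
  data _⊢_∶_ : ∀ {Δ} → List (Formula Δ) → Pf Δ → Formula Δ → Set₁ where
    ax   : ∀ {Δ} {Γ : List (Formula Δ)} {P Q} n →
           Γ !! n ≡ just Q → P ≈f Q → Γ ⊢ hyp n ∶ P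
    ⊤I   : ∀ {Δ} {Γ : List (Formula Δ)} {P} → P ≈f ⊤' → Γ ⊢ unit ∶ P
    ⊥E   : ∀ {Δ} {Γ : List (Formula Δ)} {P π} → Γ ⊢ π ∶ ⊥' → Γ ⊢ δ⊥ π ∶ P
    ⊃I   : ∀ {Δ} {Γ : List (Formula Δ)} {P P₁ P₂ π} →
           (P₁ ∷ Γ) ⊢ π ∶ P₂ → P ≈f (P₁ ⊃ P₂) → Γ ⊢ ƛ π ∶ P
    ⊃E   : ∀ {Δ} {Γ : List (Formula Δ)} {P Q π π'} →
           Γ ⊢ π ∶ (Q ⊃ P) → Γ ⊢ π' ∶ Q → Γ ⊢ π · π' ∶ P
    ∧I   : ∀ {Δ} {Γ : List (Formula Δ)} {P P₁ P₂ π₁ π₂} →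
           Γ ⊢ π₁ ∶ P₁ → Γ ⊢ π₂ ∶ P₂ → P ≈f (P₁ ∧' P₂) → Γ ⊢ pair π₁ π₂ ∶ P
    ∧E₁  : ∀ {Δ} {Γ : List (Formula Δ)} {P' P₁ P₂ π} →
           Γ ⊢ π ∶ (P₁ ∧' P₂) → P' ≈f P₁ → Γ ⊢ proj₁' π ∶ P'
    ∧E₂  : ∀ {Δ} {Γ : List (Formula Δ)} {P' P₁ P₂ π} →
           Γ ⊢ π ∶ (P₁ ∧' P₂) → P' ≈f P₂ → Γ ⊢ proj₂' π ∶ P'
    ∨I₁  : ∀ {Δ} {Γ : List (Formula Δ)} {P P₁ P₂ π} →
           Γ ⊢ π ∶ P₁ → P ≈f (P₁ ∨' P₂) → Γ ⊢ in₁ π ∶ P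
    ∨I₂  : ∀ {Δ} {Γ : List (Formula Δ)} {P P₁ P₂ π} →
           Γ ⊢ π ∶ P₂ → P ≈f (P₁ ∨' P₂) → Γ ⊢ in₂ π ∶ P
    ∨E   : ∀ {Δ} {Γ : List (Formula Δ)} {P P₁ P₂ π π₁ π₂} →
           Γ ⊢ π ∶ (P₁ ∨' P₂) → (P₁ ∷ Γ) ⊢ π₁ ∶ P → (P₂ ∷ Γ) ⊢ π₂ ∶ P →
           Γ ⊢ δ∨ π π₁ π₂ ∶ P
    ∀I   : ∀ {Δ} {Γ : List (Formula Δ)} {P τ} {Q : Formula (τ ∷ Δ)} {π} →
           wkΓ (τ ∷ []) Γ ⊢ π ∶ Q → P ≈f ∀' τ Q → Γ ⊢ Λ τ π ∶ P
    ∀E   : ∀ {Δ} {Γ : List (Formula Δ)} {P τ} {Q : Formula (τ ∷ Δ)} {π} {t : Tm Δ τ} →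
           Γ ⊢ π ∶ ∀' τ Q → P ≈f fsub ((t ∷ []) ,, var) Q → Γ ⊢ π ·t t ∶ P
    ∃I   : ∀ {Δ} {Γ : List (Formula Δ)} {P τ} {Q : Formula (τ ∷ Δ)} {π} {t : Tm Δ τ} →
           Γ ⊢ π ∶ fsub ((t ∷ []) ,, var) Q → P ≈f ∃' τ Q → Γ ⊢ ⟨ t , π ⟩t ∶ P
    ∃E   : ∀ {Δ} {Γ : List (Formula Δ)} {P τ} {Q : Formula (τ ∷ Δ)} {π π'} →
           Γ ⊢ π ∶ ∃' τ Q → (Q ∷ wkΓ (τ ∷ []) Γ) ⊢ π' ∶ fsub (wkS (τ ∷ [])) P →
           Γ ⊢ δ∃ π τ π' ∶ P
    =I   : ∀ {Δ} {Γ : List (Formula Δ)} {P τ} {t : Tm Δ τ} →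
           P ≈f eq t t → Γ ⊢ reflP t ∶ P
    =E   : ∀ {Δ} {Γ' : List (Formula Δ)} {P τ} {Δ₀} {Γ : List (Formula Δ₀)}
             {θ : Sub Δ₀ Δ} {σ : List (Pf Δ)} {u v : Tm Δ₀ τ} {Q : Formula Δ₀} {π : Pf Δ}
             {I : Set} {Δs : I → Ctx} {θs : (i : I) → Sub Δ₀ (Δs i)}
             {πs : (i : I) → Pf (Δs i)} →
           Γ' ⊢ π ∶ eq (sub θ u) (sub θ v) →
           (∀ n {π' Q'} → σ !! n ≡ just π' → ctxsub θ Γ !! n ≡ just Q' → Γ' ⊢ π' ∶ Q') →
           ((i : I) → ctxsub (θs i) Γ ⊢ πs i ∶ fsub (θs i) Q) →
           IsCSU u v I Δs θs →
           P ≈f fsub θ Q →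
           Γ' ⊢ δ≡ Δ₀ Γ θ σ u v Q π I Δs θs πs ∶ P
    μI'  : ∀ {Δ} {Γ : List (Formula Δ)} {P ar} {B : Op ar Δ} {ts : Tms Δ ar} {π} →
           Γ ⊢ π ∶ papp (Bapp B (μpred B)) ts → P ≈f μ' ar B ts →
           Γ ⊢ μI ar B ts π ∶ P
    μE   : ∀ {Δ} {Γ : List (Formula Δ)} {P ar} {B : Op ar Δ} {ts : Tms Δ ar} {π π'}
             (S : Formula (ar ++ Δ)) →
           Γ ⊢ π ∶ μ' ar B ts → (Bapp B S ∷ wkΓ ar Γ) ⊢ π' ∶ S → P ≈f papp S ts →
           Γ ⊢ δμ π ar π' ∶ P
    νI'  : ∀ {Δ} {Γ : List (Formula Δ)} {P ar} {B : Op ar Δ} {ts : Tms Δ ar} {π π'}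
             (S : Formula (ar ++ Δ)) →
           Γ ⊢ π ∶ papp S ts → (S ∷ wkΓ ar Γ) ⊢ π' ∶ Bapp B S → P ≈f ν' ar B ts →
           Γ ⊢ νI π ar π' ∶ P
    νE   : ∀ {Δ} {Γ : List (Formula Δ)} {P ar} {B : Op ar Δ} {ts : Tms Δ ar} {π} →
           Γ ⊢ π ∶ ν' ar B ts → P ≈f papp (Bapp B (νpred B)) ts →
           Γ ⊢ δν ar B ts π ∶ P

-- Every side condition P ≈f Q is preserved because ≈f is
-- closed under substitution, so the content lies in the premises whose formulas are built
-- by syntactic operations: instantiation Q[t/x], application S t⃗ of a predicate, B S and
-- the predicates μB, νB (which substitute a predicate for p), and weakening of Γ under a
-- term binder. Each of these commutes with a term substitution θ (lifted under binders).
-- For δ= only the outer unifier θ' becomes θ'θ; the branches over the csu of u, v are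
-- left untouched, so their premises are reused verbatim.
module Submission where

open import Defs
open import Data.Nat using (zero; suc)
open import Data.List using (List; []; _∷_; _++_; map)
open import Data.List.Properties using (map-++)
open import Data.Maybe using (just)
open import Data.Product using (Σ; _×_; _,_)
open import Data.Sum using (inj₁; inj₂)
open import Relation.Binary.PropositionalEquality hiding (_≗_)
open import Relation.Binary.Structures using (IsEquivalence)

module SubstitutionLaws (Sg : Sig) where
  open Syntax Sg

  infix 4 _≗_
  _≗_ : ∀ {Δ} {F : Type → Set} (f g : ∀ {τ} → Δ ∋ τ → F τ) → Set
  f ≗ g = ∀ {τ} x → f {τ} x ≡ g x

  liftR-cong : ∀ {Δ Δ' σ} {ρ ρ' : Ren Δ Δ'} → ρ ≗ ρ' → liftR {σ = σ} ρ ≗ liftR ρ'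
  liftR-cong h here      = refl
  liftR-cong h (there x) = cong there (h x)

  ren-cong : ∀ {Δ Δ' τ} {ρ ρ' : Ren Δ Δ'} → ρ ≗ ρ' → (t : Tm Δ τ) → ren ρ t ≡ ren ρ' t
  ren-cong h (var x)   = cong var (h x)
  ren-cong h (con c)   = refl
  ren-cong h (lam t)   = cong lam (ren-cong (liftR-cong h) t)
  ren-cong h (app t u) = cong₂ app (ren-cong h t) (ren-cong h u)

  ren-ren : ∀ {Δ₁ Δ₂ Δ₃ τ} (ρ : Ren Δ₁ Δ₂) (ρ' : Ren Δ₂ Δ₃) (t : Tm Δ₁ τ) →
            ren ρ' (ren ρ t) ≡ ren (λ x → ρ' (ρ x)) t
  ren-ren ρ ρ' (var x)   = refl
  ren-ren ρ ρ' (con c)   = refl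
  ren-ren ρ ρ' (lam t)   = cong lam (trans (ren-ren (liftR ρ) (liftR ρ') t)
                                      (ren-cong (λ { here → refl ; (there x) → refl }) t))
  ren-ren ρ ρ' (app t u) = cong₂ app (ren-ren ρ ρ' t) (ren-ren ρ ρ' u)

  ren-id : ∀ {Δ τ} (t : Tm Δ τ) → ren (λ x → x) t ≡ t
  ren-id (var x)   = refl
  ren-id (con c)   = refl
  ren-id (lam t)   = cong lam (trans (ren-cong (λ { here → refl ; (there x) → refl }) t) (ren-id t))
  ren-id (app t u) = cong₂ app (ren-id t) (ren-id u)

  liftS-cong : ∀ {Δ Δ' σ} {θ θ' : Sub Δ Δ'} → θ ≗ θ' → liftS {σ = σ} θ ≗ liftS θ'
  liftS-cong h here      = refl
  liftS-cong h (there x) = cong (ren there) (h x)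

  sub-cong : ∀ {Δ Δ' τ} {θ θ' : Sub Δ Δ'} → θ ≗ θ' → (t : Tm Δ τ) → sub θ t ≡ sub θ' t
  sub-cong h (var x)   = h x
  sub-cong h (con c)   = refl
  sub-cong h (lam t)   = cong lam (sub-cong (liftS-cong h) t)
  sub-cong h (app t u) = cong₂ app (sub-cong h t) (sub-cong h u)

  ren-sub : ∀ {Δ₁ Δ₂ Δ₃ τ} (θ : Sub Δ₁ Δ₂) (ρ : Ren Δ₂ Δ₃) (t : Tm Δ₁ τ) →
            ren ρ (sub θ t) ≡ sub (λ x → ren ρ (θ x)) t
  ren-sub θ ρ (var x)   = refl
  ren-sub θ ρ (con c)   = refl
  ren-sub θ ρ (lam t)   = cong lam (trans (ren-sub (liftS θ) (liftR ρ) t) (sub-cong lift-comm t))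
    where
    lift-comm : (λ x → ren (liftR ρ) (liftS θ x)) ≗ liftS (λ x → ren ρ (θ x))
    lift-comm here      = refl
    lift-comm (there x) = trans (ren-ren there (liftR ρ) (θ x)) (sym (ren-ren ρ there (θ x)))
  ren-sub θ ρ (app t u) = cong₂ app (ren-sub θ ρ t) (ren-sub θ ρ u)

  sub-ren : ∀ {Δ₁ Δ₂ Δ₃ τ} (ρ : Ren Δ₁ Δ₂) (θ : Sub Δ₂ Δ₃) (t : Tm Δ₁ τ) →
            sub θ (ren ρ t) ≡ sub (λ x → θ (ρ x)) t
  sub-ren ρ θ (var x)   = refl
  sub-ren ρ θ (con c)   = refl
  sub-ren ρ θ (lam t)   = cong lam (trans (sub-ren (liftR ρ) (liftS θ) t)
                                      (sub-cong (λ { here → refl ; (there x) → refl }) t))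
  sub-ren ρ θ (app t u) = cong₂ app (sub-ren ρ θ t) (sub-ren ρ θ u)

  liftS-⨾ : ∀ {Δ₁ Δ₂ Δ₃ σ} (ρ : Sub Δ₁ Δ₂) (θ : Sub Δ₂ Δ₃) →
            liftS {σ = σ} ρ ⨾ liftS θ ≗ liftS (ρ ⨾ θ)
  liftS-⨾ ρ θ here      = refl
  liftS-⨾ ρ θ (there x) = trans (sub-ren there (liftS θ) (ρ x)) (sym (ren-sub θ there (ρ x)))

  sub-sub : ∀ {Δ₁ Δ₂ Δ₃ τ} (ρ : Sub Δ₁ Δ₂) (θ : Sub Δ₂ Δ₃) (t : Tm Δ₁ τ) →
            sub θ (sub ρ t) ≡ sub (ρ ⨾ θ) t
  sub-sub ρ θ (var x)   = refl
  sub-sub ρ θ (con c)   = refl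
  sub-sub ρ θ (lam t)   = cong lam (trans (sub-sub (liftS ρ) (liftS θ) t) (sub-cong (liftS-⨾ ρ θ) t))
  sub-sub ρ θ (app t u) = cong₂ app (sub-sub ρ θ t) (sub-sub ρ θ u)

  sub-var∘ : ∀ {Δ Δ' τ} (ρ : Ren Δ Δ') (t : Tm Δ τ) → sub (λ x → var (ρ x)) t ≡ ren ρ t
  sub-var∘ ρ (var x)   = refl
  sub-var∘ ρ (con c)   = refl
  sub-var∘ ρ (lam t)   = cong lam (trans (sub-cong (λ { here → refl ; (there x) → refl }) t)
                                          (sub-var∘ (liftR ρ) t))
  sub-var∘ ρ (app t u) = cong₂ app (sub-var∘ ρ t) (sub-var∘ ρ u)

  sub-id : ∀ {Δ τ} (t : Tm Δ τ) → sub var t ≡ t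
  sub-id t = trans (sub-var∘ (λ x → x) t) (ren-id t)

  ⨾-assoc : ∀ {Δ₁ Δ₂ Δ₃ Δ₄} (a : Sub Δ₁ Δ₂) (b : Sub Δ₂ Δ₃) (c : Sub Δ₃ Δ₄) →
            (a ⨾ b) ⨾ c ≗ a ⨾ (b ⨾ c)
  ⨾-assoc a b c x = sub-sub b c (a x)

  ⨾-cong : ∀ {Δ₁ Δ₂ Δ₃} {a a' : Sub Δ₁ Δ₂} {b b' : Sub Δ₂ Δ₃} → a ≗ a' → b ≗ b' → a ⨾ b ≗ a' ⨾ b'
  ⨾-cong {a' = a'} {b = b} ha hb x = trans (cong (sub b) (ha x)) (sub-cong hb (a' x))

  liftSN-cong : ∀ {Δ Δ'} (ar : Arity) {θ θ' : Sub Δ Δ'} → θ ≗ θ' → liftSN ar θ ≗ liftSN ar θ'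
  liftSN-cong []       h = h
  liftSN-cong (τ ∷ ar) h = liftS-cong (liftSN-cong ar h)

  liftSN-⨾ : ∀ {Δ₁ Δ₂ Δ₃} (ar : Arity) (ρ : Sub Δ₁ Δ₂) (θ : Sub Δ₂ Δ₃) →
             liftSN ar ρ ⨾ liftSN ar θ ≗ liftSN ar (ρ ⨾ θ)
  liftSN-⨾ []       ρ θ x = refl
  liftSN-⨾ (τ ∷ ar) ρ θ x =
    trans (liftS-⨾ (liftSN ar ρ) (liftSN ar θ) x) (liftS-cong (liftSN-⨾ ar ρ θ) x)

  liftSN-square : ∀ {Δ₁ Δ₂ Δ₃ Δ₄} (ar : Arity) {ρ₁ : Sub Δ₁ Δ₂} {θ₂ : Sub Δ₂ Δ₄}
                  {θ₁ : Sub Δ₁ Δ₃} {ρ₂ : Sub Δ₃ Δ₄} → ρ₁ ⨾ θ₂ ≗ θ₁ ⨾ ρ₂ →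
                  liftSN ar ρ₁ ⨾ liftSN ar θ₂ ≗ liftSN ar θ₁ ⨾ liftSN ar ρ₂
  liftSN-square ar {ρ₁} {θ₂} {θ₁} {ρ₂} h x =
    trans (liftSN-⨾ ar ρ₁ θ₂ x) (trans (liftSN-cong ar h x) (sym (liftSN-⨾ ar θ₁ ρ₂ x)))

  wkS-⨾-liftSN : ∀ {Δ Δ'} (ar : Arity) (θ : Sub Δ Δ') → wkS ar ⨾ liftSN ar θ ≗ θ ⨾ wkS ar
  wkS-⨾-liftSN ar θ x = trans (liftSN-wkN ar x) (sym (sub-var∘ (wkN ar) (θ x)))
    where
    liftSN-wkN : ∀ ar {τ} (x : _ ∋ τ) → liftSN ar θ (wkN ar x) ≡ ren (wkN ar) (θ x)
    liftSN-wkN []       x = sym (ren-id (θ x))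
    liftSN-wkN (τ ∷ ar) x = trans (cong (ren there) (liftSN-wkN ar x)) (ren-ren (wkN ar) there (θ x))

  ⨾-wkS-⨾-liftSN : ∀ {Δ₀ Δ Δ'} (ar : Arity) (ρ : Sub Δ₀ Δ) (θ : Sub Δ Δ') →
                   (ρ ⨾ wkS ar) ⨾ liftSN ar θ ≗ (ρ ⨾ θ) ⨾ wkS ar
  ⨾-wkS-⨾-liftSN ar ρ θ x = trans (⨾-assoc ρ (wkS ar) (liftSN ar θ) x)
    (trans (sub-cong (wkS-⨾-liftSN ar θ) (ρ x)) (sym (⨾-assoc ρ θ (wkS ar) x)))

  subs-cong : ∀ {Δ Δ' ar} {θ θ' : Sub Δ Δ'} → θ ≗ θ' → (ts : Tms Δ ar) → subs θ ts ≡ subs θ' ts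
  subs-cong h []       = refl
  subs-cong h (t ∷ ts) = cong₂ _∷_ (sub-cong h t) (subs-cong h ts)

  subs-subs : ∀ {Δ₁ Δ₂ Δ₃ ar} (ρ : Sub Δ₁ Δ₂) (θ : Sub Δ₂ Δ₃) (ts : Tms Δ₁ ar) →
              subs θ (subs ρ ts) ≡ subs (ρ ⨾ θ) ts
  subs-subs ρ θ []       = refl
  subs-subs ρ θ (t ∷ ts) = cong₂ _∷_ (sub-sub ρ θ t) (subs-subs ρ θ ts)

  subs-rens : ∀ {Δ₁ Δ₂ Δ₃ ar} (ρ : Ren Δ₁ Δ₂) (θ : Sub Δ₂ Δ₃) (ts : Tms Δ₁ ar) →
              subs θ (rens ρ ts) ≡ subs (λ x → θ (ρ x)) ts
  subs-rens ρ θ []       = refl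
  subs-rens ρ θ (t ∷ ts) = cong₂ _∷_ (sub-ren ρ θ t) (subs-rens ρ θ ts)

  rens-subs : ∀ {Δ₁ Δ₂ Δ₃ ar} (θ : Sub Δ₁ Δ₂) (ρ : Ren Δ₂ Δ₃) (ts : Tms Δ₁ ar) →
              rens ρ (subs θ ts) ≡ subs (λ x → ren ρ (θ x)) ts
  rens-subs θ ρ []       = refl
  rens-subs θ ρ (t ∷ ts) = cong₂ _∷_ (ren-sub θ ρ t) (rens-subs θ ρ ts)

  subs-liftSN-vars : ∀ {Δ Δ'} (ar : Arity) (θ : Sub Δ Δ') → subs (liftSN ar θ) (vars ar) ≡ vars ar
  subs-liftSN-vars []       θ = refl
  subs-liftSN-vars (τ ∷ ar) θ = cong (var here ∷_) (begin
    subs (liftS (liftSN ar θ)) (rens there (vars ar)) ≡⟨ subs-rens there (liftS (liftSN ar θ)) (vars ar) ⟩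
    subs (λ x → ren there (liftSN ar θ x)) (vars ar)  ≡⟨ rens-subs (liftSN ar θ) there (vars ar) ⟨
    rens there (subs (liftSN ar θ) (vars ar))         ≡⟨ cong (rens there) (subs-liftSN-vars ar θ) ⟩
    rens there (vars ar)                              ∎)
    where open ≡-Reasoning

  ,,-cong : ∀ {Δ Δ' ar} (ts : Tms Δ' ar) {ρ ρ' : Sub Δ Δ'} → ρ ≗ ρ' → (ts ,, ρ) ≗ (ts ,, ρ')
  ,,-cong []       h x         = h x
  ,,-cong (t ∷ ts) h here      = refl
  ,,-cong (t ∷ ts) h (there x) = ,,-cong ts h x

  ,,-⨾ : ∀ {Δ Δ' Δ'' ar} (ts : Tms Δ' ar) (ρ : Sub Δ Δ') (θ : Sub Δ' Δ'') →
         (ts ,, ρ) ⨾ θ ≗ (subs θ ts ,, (ρ ⨾ θ))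
  ,,-⨾ []       ρ θ x         = refl
  ,,-⨾ (t ∷ ts) ρ θ here      = refl
  ,,-⨾ (t ∷ ts) ρ θ (there x) = ,,-⨾ ts ρ θ x

  liftSN-⨾-,, : ∀ {Δ Δ' Δ'' ar} (θ : Sub Δ Δ') (ts : Tms Δ'' ar) (ρ : Sub Δ' Δ'') →
                liftSN ar θ ⨾ (ts ,, ρ) ≗ (ts ,, (θ ⨾ ρ))
  liftSN-⨾-,, θ []       ρ x         = refl
  liftSN-⨾-,, θ (t ∷ ts) ρ here      = refl
  liftSN-⨾-,, {ar = τ ∷ ar} θ (t ∷ ts) ρ (there x) =
    trans (sub-ren there ((t ∷ ts) ,, ρ) (liftSN ar θ x)) (liftSN-⨾-,, θ ts ρ x)

  fsub-cong : ∀ {Ψ Δ Δ'} {θ θ' : Sub Δ Δ'} → θ ≗ θ' → (A : Fm Ψ Δ) → fsub θ A ≡ fsub θ' A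
  fsub-cong h ⊤'           = refl
  fsub-cong h ⊥'           = refl
  fsub-cong h (A ⊃ C)      = cong₂ _⊃_ (fsub-cong h A) (fsub-cong h C)
  fsub-cong h (A ∧' C)     = cong₂ _∧'_ (fsub-cong h A) (fsub-cong h C)
  fsub-cong h (A ∨' C)     = cong₂ _∨'_ (fsub-cong h A) (fsub-cong h C)
  fsub-cong h (∀' τ A)     = cong (∀' τ) (fsub-cong (liftS-cong h) A)
  fsub-cong h (∃' τ A)     = cong (∃' τ) (fsub-cong (liftS-cong h) A)
  fsub-cong h (eq t u)     = cong₂ eq (sub-cong h t) (sub-cong h u)
  fsub-cong h (μ' ar B ts) = cong₂ (μ' ar) (fsub-cong (liftSN-cong ar h) B) (subs-cong h ts)
  fsub-cong h (ν' ar B ts) = cong₂ (ν' ar) (fsub-cong (liftSN-cong ar h) B) (subs-cong h ts)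
  fsub-cong h (pv p ts)    = cong (pv p) (subs-cong h ts)
  fsub-cong h (pc a ts)    = cong (pc a) (subs-cong h ts)

  fsub-fsub : ∀ {Ψ Δ₁ Δ₂ Δ₃} (ρ : Sub Δ₁ Δ₂) (θ : Sub Δ₂ Δ₃) (A : Fm Ψ Δ₁) →
              fsub θ (fsub ρ A) ≡ fsub (ρ ⨾ θ) A
  fsub-fsub ρ θ ⊤'           = refl
  fsub-fsub ρ θ ⊥'           = refl
  fsub-fsub ρ θ (A ⊃ C)      = cong₂ _⊃_ (fsub-fsub ρ θ A) (fsub-fsub ρ θ C)
  fsub-fsub ρ θ (A ∧' C)     = cong₂ _∧'_ (fsub-fsub ρ θ A) (fsub-fsub ρ θ C)
  fsub-fsub ρ θ (A ∨' C)     = cong₂ _∨'_ (fsub-fsub ρ θ A) (fsub-fsub ρ θ C)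
  fsub-fsub ρ θ (∀' τ A)     =
    cong (∀' τ) (trans (fsub-fsub (liftS ρ) (liftS θ) A) (fsub-cong (liftS-⨾ ρ θ) A))
  fsub-fsub ρ θ (∃' τ A)     =
    cong (∃' τ) (trans (fsub-fsub (liftS ρ) (liftS θ) A) (fsub-cong (liftS-⨾ ρ θ) A))
  fsub-fsub ρ θ (eq t u)     = cong₂ eq (sub-sub ρ θ t) (sub-sub ρ θ u)
  fsub-fsub ρ θ (μ' ar B ts) = cong₂ (μ' ar)
    (trans (fsub-fsub (liftSN ar ρ) (liftSN ar θ) B) (fsub-cong (liftSN-⨾ ar ρ θ) B)) (subs-subs ρ θ ts)
  fsub-fsub ρ θ (ν' ar B ts) = cong₂ (ν' ar)
    (trans (fsub-fsub (liftSN ar ρ) (liftSN ar θ) B) (fsub-cong (liftSN-⨾ ar ρ θ) B)) (subs-subs ρ θ ts)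
  fsub-fsub ρ θ (pv p ts)    = cong (pv p) (subs-subs ρ θ ts)
  fsub-fsub ρ θ (pc a ts)    = cong (pc a) (subs-subs ρ θ ts)

  fsub-square : ∀ {Ψ Δ₁ Δ₂ Δ₃ Δ₄} {ρ₁ : Sub Δ₁ Δ₂} {θ₂ : Sub Δ₂ Δ₄}
                {θ₁ : Sub Δ₁ Δ₃} {ρ₂ : Sub Δ₃ Δ₄} → ρ₁ ⨾ θ₂ ≗ θ₁ ⨾ ρ₂ →
                (A : Fm Ψ Δ₁) → fsub θ₂ (fsub ρ₁ A) ≡ fsub ρ₂ (fsub θ₁ A)
  fsub-square {ρ₁ = ρ₁} {θ₂} {θ₁} {ρ₂} h A =
    trans (fsub-fsub ρ₁ θ₂ A) (trans (fsub-cong h A) (sym (fsub-fsub θ₁ ρ₂ A)))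

  fsub-liftSN-wkS : ∀ {Ψ Δ Δ'} (ar : Arity) (θ : Sub Δ Δ') (A : Fm Ψ Δ) →
                    fsub (liftSN ar θ) (fsub (wkS ar) A) ≡ fsub (wkS ar) (fsub θ A)
  fsub-liftSN-wkS ar θ = fsub-square (wkS-⨾-liftSN ar θ)

  fsub-subst : ∀ {Φ Φ' Δ Δ'} (θ : Sub Δ Δ') (e : Φ ≡ Φ') (A : Fm Φ Δ) →
               fsub θ (subst (λ X → Fm X Δ) e A) ≡ subst (λ X → Fm X Δ') e (fsub θ A)
  fsub-subst θ refl A = refl

  fsub-pweaken : ∀ {Φ Δ Δ'} (Ψ : PCtx) (θ : Sub Δ Δ') (A : Fm Φ Δ) →
                 fsub θ (pweaken Ψ A) ≡ pweaken Ψ (fsub θ A)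
  fsub-pweaken Ψ θ ⊤'           = refl
  fsub-pweaken Ψ θ ⊥'           = refl
  fsub-pweaken {Φ} Ψ θ (A ⊃ C)  = cong₂ _⊃_
    (trans (fsub-subst θ (sym (map-++ flipE Φ Ψ)) (pweaken (flipP Ψ) A))
           (cong (subst _ _) (fsub-pweaken (flipP Ψ) θ A)))
    (fsub-pweaken Ψ θ C)
  fsub-pweaken Ψ θ (A ∧' C)     = cong₂ _∧'_ (fsub-pweaken Ψ θ A) (fsub-pweaken Ψ θ C)
  fsub-pweaken Ψ θ (A ∨' C)     = cong₂ _∨'_ (fsub-pweaken Ψ θ A) (fsub-pweaken Ψ θ C)
  fsub-pweaken Ψ θ (∀' τ A)     = cong (∀' τ) (fsub-pweaken Ψ (liftS θ) A)
  fsub-pweaken Ψ θ (∃' τ A)     = cong (∃' τ) (fsub-pweaken Ψ (liftS θ) A)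
  fsub-pweaken Ψ θ (eq t u)     = refl
  fsub-pweaken Ψ θ (μ' ar B ts) = cong (λ X → μ' ar X (subs θ ts)) (fsub-pweaken Ψ (liftSN ar θ) B)
  fsub-pweaken Ψ θ (ν' ar B ts) = cong (λ X → ν' ar X (subs θ ts)) (fsub-pweaken Ψ (liftSN ar θ) B)
  fsub-pweaken Ψ θ (pv p ts)    = refl
  fsub-pweaken Ψ θ (pc a ts)    = refl

  psub-cong : ∀ {Ψ Δ Δ₀ ar b} (Φ : PCtx) (e : Ψ ≡ Φ ++ (ar , b) ∷ []) (S : Fm [] (ar ++ Δ₀))
              {ρ ρ' : Sub Δ₀ Δ} → ρ ≗ ρ' → (A : Fm Ψ Δ) → psub Φ e S ρ A ≡ psub Φ e S ρ' A
  psub-cong Φ e S h ⊤'            = refl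
  psub-cong Φ e S h ⊥'            = refl
  psub-cong Φ e S h (A ⊃ C)       = cong₂ _⊃_ (psub-cong _ _ S h A) (psub-cong Φ e S h C)
  psub-cong Φ e S h (A ∧' C)      = cong₂ _∧'_ (psub-cong Φ e S h A) (psub-cong Φ e S h C)
  psub-cong Φ e S h (A ∨' C)      = cong₂ _∨'_ (psub-cong Φ e S h A) (psub-cong Φ e S h C)
  psub-cong Φ e S h (∀' τ A)      = cong (∀' τ) (psub-cong Φ e S (⨾-cong h λ _ → refl) A)
  psub-cong Φ e S h (∃' τ A)      = cong (∃' τ) (psub-cong Φ e S (⨾-cong h λ _ → refl) A)
  psub-cong Φ e S h (eq t u)      = refl
  psub-cong Φ e S h (μ' ar' B ts) = cong (λ X → μ' ar' X ts) (psub-cong _ _ S (⨾-cong h λ _ → refl) B)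
  psub-cong Φ e S h (ν' ar' B ts) = cong (λ X → ν' ar' X ts) (psub-cong _ _ S (⨾-cong h λ _ → refl) B)
  psub-cong Φ e S h (pv p ts) with ∋-snoc Φ (subst (_∋ _) e p)
  ... | inj₁ q    = refl
  ... | inj₂ refl = cong (pweaken Φ) (fsub-cong (,,-cong ts h) S)
  psub-cong Φ e S h (pc a ts)     = refl

  fsub-psub-under : ∀ {Ψ Δ Δ' Δ₀ ar b} (Φ : PCtx) (e : Ψ ≡ Φ ++ (ar , b) ∷ []) (S : Fm [] (ar ++ Δ₀))
                    (ρ : Sub Δ₀ Δ) (θ : Sub Δ Δ') (ar' : Arity) (A : Fm Ψ (ar' ++ Δ)) →
                    fsub (liftSN ar' θ) (psub Φ e S (ρ ⨾ wkS ar') A)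
                      ≡ psub Φ e S ((ρ ⨾ θ) ⨾ wkS ar') (fsub (liftSN ar' θ) A)

  fsub-psub : ∀ {Ψ Δ Δ' Δ₀ ar b} (Φ : PCtx) (e : Ψ ≡ Φ ++ (ar , b) ∷ []) (S : Fm [] (ar ++ Δ₀))
              (ρ : Sub Δ₀ Δ) (θ : Sub Δ Δ') (A : Fm Ψ Δ) →
              fsub θ (psub Φ e S ρ A) ≡ psub Φ e S (ρ ⨾ θ) (fsub θ A)
  fsub-psub Φ e S ρ θ ⊤'            = refl
  fsub-psub Φ e S ρ θ ⊥'            = refl
  fsub-psub Φ e S ρ θ (A ⊃ C)       = cong₂ _⊃_ (fsub-psub _ _ S ρ θ A) (fsub-psub Φ e S ρ θ C)
  fsub-psub Φ e S ρ θ (A ∧' C)      = cong₂ _∧'_ (fsub-psub Φ e S ρ θ A) (fsub-psub Φ e S ρ θ C)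
  fsub-psub Φ e S ρ θ (A ∨' C)      = cong₂ _∨'_ (fsub-psub Φ e S ρ θ A) (fsub-psub Φ e S ρ θ C)
  fsub-psub Φ e S ρ θ (∀' τ A)      = cong (∀' τ) (fsub-psub-under Φ e S ρ θ (τ ∷ []) A)
  fsub-psub Φ e S ρ θ (∃' τ A)      = cong (∃' τ) (fsub-psub-under Φ e S ρ θ (τ ∷ []) A)
  fsub-psub Φ e S ρ θ (eq t u)      = refl
  fsub-psub Φ e S ρ θ (μ' ar' B ts) = cong (λ X → μ' ar' X (subs θ ts)) (fsub-psub-under _ _ S ρ θ ar' B)
  fsub-psub Φ e S ρ θ (ν' ar' B ts) = cong (λ X → ν' ar' X (subs θ ts)) (fsub-psub-under _ _ S ρ θ ar' B)
  fsub-psub Φ e S ρ θ (pv p ts) with ∋-snoc Φ (subst (_∋ _) e p)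
  ... | inj₁ q    = refl
  ... | inj₂ refl = trans (fsub-pweaken Φ θ (fsub (ts ,, ρ) S))
                      (cong (pweaken Φ) (trans (fsub-fsub (ts ,, ρ) θ S) (fsub-cong (,,-⨾ ts ρ θ) S)))
  fsub-psub Φ e S ρ θ (pc a ts)     = refl

  fsub-psub-under Φ e S ρ θ ar' A = trans (fsub-psub Φ e S (ρ ⨾ wkS ar') (liftSN ar' θ) A)
    (psub-cong Φ e S (⨾-wkS-⨾-liftSN ar' ρ θ) (fsub (liftSN ar' θ) A))

  psub-fsub-liftSN : ∀ {Ψ Δ Δ₀ Δ₁ ar b} (Φ : PCtx) (e : Ψ ≡ Φ ++ (ar , b) ∷ []) (S : Fm [] (ar ++ Δ₀))
                     (θ : Sub Δ₀ Δ₁) (ρ : Sub Δ₁ Δ) (A : Fm Ψ Δ) →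
                     psub Φ e (fsub (liftSN ar θ) S) ρ A ≡ psub Φ e S (θ ⨾ ρ) A
  psub-fsub-liftSN-under : ∀ {Ψ Δ Δ₀ Δ₁ ar b} (Φ : PCtx) (e : Ψ ≡ Φ ++ (ar , b) ∷ [])
                           (S : Fm [] (ar ++ Δ₀)) (θ : Sub Δ₀ Δ₁) (ρ : Sub Δ₁ Δ)
                           (ar' : Arity) (A : Fm Ψ (ar' ++ Δ)) →
                           psub Φ e (fsub (liftSN ar θ) S) (ρ ⨾ wkS ar') A
                             ≡ psub Φ e S ((θ ⨾ ρ) ⨾ wkS ar') A

  psub-fsub-liftSN Φ e S θ ρ ⊤'            = refl
  psub-fsub-liftSN Φ e S θ ρ ⊥'            = refl
  psub-fsub-liftSN Φ e S θ ρ (A ⊃ C)       =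
    cong₂ _⊃_ (psub-fsub-liftSN _ _ S θ ρ A) (psub-fsub-liftSN Φ e S θ ρ C)
  psub-fsub-liftSN Φ e S θ ρ (A ∧' C)      =
    cong₂ _∧'_ (psub-fsub-liftSN Φ e S θ ρ A) (psub-fsub-liftSN Φ e S θ ρ C)
  psub-fsub-liftSN Φ e S θ ρ (A ∨' C)      =
    cong₂ _∨'_ (psub-fsub-liftSN Φ e S θ ρ A) (psub-fsub-liftSN Φ e S θ ρ C)
  psub-fsub-liftSN Φ e S θ ρ (∀' τ A)      = cong (∀' τ) (psub-fsub-liftSN-under Φ e S θ ρ (τ ∷ []) A)
  psub-fsub-liftSN Φ e S θ ρ (∃' τ A)      = cong (∃' τ) (psub-fsub-liftSN-under Φ e S θ ρ (τ ∷ []) A)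
  psub-fsub-liftSN Φ e S θ ρ (eq t u)      = refl
  psub-fsub-liftSN Φ e S θ ρ (μ' ar' B ts) = cong (λ X → μ' ar' X ts) (psub-fsub-liftSN-under _ _ S θ ρ ar' B)
  psub-fsub-liftSN Φ e S θ ρ (ν' ar' B ts) = cong (λ X → ν' ar' X ts) (psub-fsub-liftSN-under _ _ S θ ρ ar' B)
  psub-fsub-liftSN Φ e S θ ρ (pv p ts) with ∋-snoc Φ (subst (_∋ _) e p)
  ... | inj₁ q    = refl
  ... | inj₂ refl = cong (pweaken Φ)
                      (trans (fsub-fsub (liftSN _ θ) (ts ,, ρ) S) (fsub-cong (liftSN-⨾-,, θ ts ρ) S))
  psub-fsub-liftSN Φ e S θ ρ (pc a ts)     = refl

  psub-fsub-liftSN-under Φ e S θ ρ ar' A = trans (psub-fsub-liftSN Φ e S θ (ρ ⨾ wkS ar') A)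
    (psub-cong Φ e S (λ x → sym (⨾-assoc θ ρ (wkS ar') x)) A)

  fsub-papp : ∀ {Δ Δ' ar} (θ : Sub Δ Δ') (S : Formula (ar ++ Δ)) (ts : Tms Δ ar) →
              fsub θ (papp S ts) ≡ papp (fsub (liftSN ar θ) S) (subs θ ts)
  fsub-papp {ar = ar} θ S ts = fsub-square ,,-square S
    where
    ,,-square : (ts ,, var) ⨾ θ ≗ liftSN ar θ ⨾ (subs θ ts ,, var)
    ,,-square x = begin
      ((ts ,, var) ⨾ θ) x          ≡⟨ ,,-⨾ ts var θ x ⟩
      (subs θ ts ,, (var ⨾ θ)) x   ≡⟨ ,,-cong (subs θ ts) (λ y → sym (sub-id (θ y))) x ⟩
      (subs θ ts ,, (θ ⨾ var)) x   ≡⟨ liftSN-⨾-,, θ (subs θ ts) var x ⟨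
      (liftSN ar θ ⨾ (subs θ ts ,, var)) x ∎
      where open ≡-Reasoning

  fsub-Bapp : ∀ {Δ Δ' ar} (θ : Sub Δ Δ') (B : Op ar Δ) (S : Formula (ar ++ Δ)) →
              fsub (liftSN ar θ) (Bapp B S) ≡ Bapp (fsub (liftSN ar θ) B) (fsub (liftSN ar θ) S)
  fsub-Bapp {Δ' = Δ'} {ar} θ B S = begin
    fsub (liftSN ar θ) (psub [] refl S (wkS ar) B) ≡⟨ fsub-psub [] refl S (wkS ar) (liftSN ar θ) B ⟩
    psub [] refl S (wkS ar ⨾ liftSN ar θ) Bθ       ≡⟨ psub-cong [] refl S (wkS-⨾-liftSN ar θ) Bθ ⟩
    psub [] refl S (θ ⨾ wkS ar) Bθ                 ≡⟨ psub-fsub-liftSN [] refl S θ (wkS ar) Bθ ⟨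
    psub [] refl (fsub (liftSN ar θ) S) (wkS ar) Bθ ∎
    where
    open ≡-Reasoning
    Bθ : Op ar Δ'
    Bθ = fsub (liftSN ar θ) B

  fsub-fixpoint-body : ∀ {Δ Δ' ar} (θ : Sub Δ Δ') (B : Op ar Δ) →
                       fsub (liftSN ar (liftSN ar θ)) (fsub (liftSN ar (wkS ar)) B)
                         ≡ fsub (liftSN ar (wkS ar)) (fsub (liftSN ar θ) B)
  fsub-fixpoint-body {ar = ar} θ = fsub-square (liftSN-square ar (wkS-⨾-liftSN ar θ))

  fsub-μpred : ∀ {Δ Δ' ar} (θ : Sub Δ Δ') (B : Op ar Δ) →
               fsub (liftSN ar θ) (μpred B) ≡ μpred (fsub (liftSN ar θ) B)
  fsub-μpred {ar = ar} θ B = cong₂ (μ' ar) (fsub-fixpoint-body θ B) (subs-liftSN-vars ar θ)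

  fsub-νpred : ∀ {Δ Δ' ar} (θ : Sub Δ Δ') (B : Op ar Δ) →
               fsub (liftSN ar θ) (νpred B) ≡ νpred (fsub (liftSN ar θ) B)
  fsub-νpred {ar = ar} θ B = cong₂ (ν' ar) (fsub-fixpoint-body θ B) (subs-liftSN-vars ar θ)

  fsub-unfold : ∀ {Δ Δ' ar} (θ : Sub Δ Δ') (B : Op ar Δ) {X : Formula (ar ++ Δ)} {X'} (ts : Tms Δ ar) →
                fsub (liftSN ar θ) X ≡ X' →
                fsub θ (papp (Bapp B X) ts) ≡ papp (Bapp (fsub (liftSN ar θ) B) X') (subs θ ts)
  fsub-unfold θ B {X} ts refl =
    trans (fsub-papp θ (Bapp B X) ts) (cong (λ Y → papp Y (subs θ ts)) (fsub-Bapp θ B X))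

  ctxsub-wkΓ : ∀ {Δ Δ'} (ar : Arity) (θ : Sub Δ Δ') (Γ : List (Formula Δ)) →
               ctxsub (liftSN ar θ) (ctxsub (wkS ar) Γ) ≡ ctxsub (wkS ar) (ctxsub θ Γ)
  ctxsub-wkΓ ar θ []      = refl
  ctxsub-wkΓ ar θ (A ∷ Γ) = cong₂ _∷_ (fsub-liftSN-wkS ar θ A) (ctxsub-wkΓ ar θ Γ)

  pfsubs-map : ∀ {Δ Δ'} (θ : Sub Δ Δ') (σ : List (Pf Δ)) → pfsubs θ σ ≡ map (pfsub θ) σ
  pfsubs-map θ []      = refl
  pfsubs-map θ (π ∷ σ) = cong (pfsub θ π ∷_) (pfsubs-map θ σ)

!!-map : ∀ {a b} {A : Set a} {B : Set b} (f : A → B) (xs : List A) n {x} → xs !! n ≡ just x → map f xs !! n ≡ just (f x)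
!!-map f []       n       ()
!!-map f (y ∷ xs) zero    refl = refl
!!-map f (y ∷ xs) (suc n) e    = !!-map f xs n e

!!-map⁻ : ∀ {a b} {A : Set a} {B : Set b} (f : A → B) (xs : List A) n {y} → map f xs !! n ≡ just y →
          Σ A λ x → xs !! n ≡ just x × y ≡ f x
!!-map⁻ f []       n       ()
!!-map⁻ f (x ∷ xs) zero    refl = x , refl , refl
!!-map⁻ f (x ∷ xs) (suc n) e    = !!-map⁻ f xs n e

module SubstitutionTyping (Sg : Sig) (E : Syntax.Congruence Sg) where
  open Syntax Sg
  open Syntax.Congruence E
  open Typing Sg E
  open SubstitutionLaws Sg
  open module ≈f {Ψ} {Δ} = IsEquivalence (≈f-equiv {Ψ} {Δ})
    using () renaming (trans to ≈f-trans; reflexive to ≈f-reflexive)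

  ⊢-cast : ∀ {Δ} {Γ₁ Γ₂ : List (Formula Δ)} {π P₁ P₂} → Γ₁ ≡ Γ₂ → P₁ ≡ P₂ →
           Γ₁ ⊢ π ∶ P₁ → Γ₂ ⊢ π ∶ P₂
  ⊢-cast refl refl d = d

  ≈f-sub-≡ : ∀ {Δ Δ'} (θ : Sub Δ Δ') {P Q : Formula Δ} {Q'} →
             P ≈f Q → fsub θ Q ≡ Q' → fsub θ P ≈f Q'
  ≈f-sub-≡ θ h e = ≈f-trans (≈f-sub θ h) (≈f-reflexive e)

  ⊢-sub : ∀ {Δ Δ'} {Γ : List (Formula Δ)} {π : Pf Δ} {P : Formula Δ} (θ : Sub Δ Δ') →
          Γ ⊢ π ∶ P → ctxsub θ Γ ⊢ pfsub θ π ∶ fsub θ P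
  ⊢-sub {Γ = Γ} θ (ax n e h) = ax n (!!-map (fsub θ) Γ n e) (≈f-sub θ h)
  ⊢-sub θ (⊤I h)          = ⊤I (≈f-sub θ h)
  ⊢-sub θ (⊥E d)          = ⊥E (⊢-sub θ d)
  ⊢-sub θ (⊃I d h)        = ⊃I (⊢-sub θ d) (≈f-sub θ h)
  ⊢-sub θ (⊃E d d')       = ⊃E (⊢-sub θ d) (⊢-sub θ d')
  ⊢-sub θ (∧I d d' h)     = ∧I (⊢-sub θ d) (⊢-sub θ d') (≈f-sub θ h)
  ⊢-sub θ (∧E₁ d h)       = ∧E₁ (⊢-sub θ d) (≈f-sub θ h)
  ⊢-sub θ (∧E₂ d h)       = ∧E₂ (⊢-sub θ d) (≈f-sub θ h)
  ⊢-sub θ (∨I₁ d h)       = ∨I₁ (⊢-sub θ d) (≈f-sub θ h)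
  ⊢-sub θ (∨I₂ d h)       = ∨I₂ (⊢-sub θ d) (≈f-sub θ h)
  ⊢-sub θ (∨E d d₁ d₂)    = ∨E (⊢-sub θ d) (⊢-sub θ d₁) (⊢-sub θ d₂)
  ⊢-sub {Γ = Γ} θ (∀I {τ = τ} d h) =
    ∀I (⊢-cast (ctxsub-wkΓ (τ ∷ []) θ Γ) refl (⊢-sub (liftS θ) d)) (≈f-sub θ h)
  ⊢-sub θ (∀E {Q = Q} {t = t} d h) =
    ∀E (⊢-sub θ d) (≈f-sub-≡ θ h (fsub-papp θ Q (t ∷ [])))
  ⊢-sub θ (∃I {Q = Q} {t = t} d h) =
    ∃I (⊢-cast refl (fsub-papp θ Q (t ∷ [])) (⊢-sub θ d)) (≈f-sub θ h)
  ⊢-sub {Γ = Γ} θ (∃E {P = P} {τ = τ} d d') =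
    ∃E (⊢-sub θ d) (⊢-cast (cong (_ ∷_) (ctxsub-wkΓ (τ ∷ []) θ Γ)) (fsub-liftSN-wkS (τ ∷ []) θ P)
                      (⊢-sub (liftS θ) d'))
  ⊢-sub θ (=I h)          = =I (≈f-sub θ h)
  ⊢-sub {Γ = Γ} θ (=E {Γ = Γ₀} {θ = θ'} {σ = σ} {u = u} {v = v} {Q = Q} d dσ dᵢ csu h) =
    =E (⊢-cast refl (cong₂ eq (sub-sub θ' θ u) (sub-sub θ' θ v)) (⊢-sub θ d))
       dσθ dᵢ csu (≈f-sub-≡ θ h (fsub-fsub θ' θ Q))
    where
    dσθ : ∀ n {π' Q'} → pfsubs θ σ !! n ≡ just π' → ctxsub (θ' ⨾ θ) Γ₀ !! n ≡ just Q' →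
          ctxsub θ Γ ⊢ π' ∶ Q'
    dσθ n eπ eQ with !!-map⁻ (pfsub θ) σ n (subst (λ σθ → σθ !! n ≡ _) (pfsubs-map θ σ) eπ)
                   | !!-map⁻ (fsub (θ' ⨾ θ)) Γ₀ n eQ
    ... | π₀ , eπ₀ , refl | A , eA , refl =
      ⊢-cast refl (fsub-fsub θ' θ A) (⊢-sub θ (dσ n eπ₀ (!!-map (fsub θ') Γ₀ n eA)))
  ⊢-sub θ (μI' {B = B} {ts = ts} d h) =
    μI' (⊢-cast refl (fsub-unfold θ B ts (fsub-μpred θ B)) (⊢-sub θ d)) (≈f-sub θ h)
  ⊢-sub {Γ = Γ} θ (μE {ar = ar} {B = B} {ts = ts} S d d' h) =
    μE (fsub (liftSN ar θ) S) (⊢-sub θ d)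
       (⊢-cast (cong₂ _∷_ (fsub-Bapp θ B S) (ctxsub-wkΓ ar θ Γ)) refl (⊢-sub (liftSN ar θ) d'))
       (≈f-sub-≡ θ h (fsub-papp θ S ts))
  ⊢-sub {Γ = Γ} θ (νI' {ar = ar} {B = B} {ts = ts} S d d' h) =
    νI' (fsub (liftSN ar θ) S) (⊢-cast refl (fsub-papp θ S ts) (⊢-sub θ d))
        (⊢-cast (cong (_ ∷_) (ctxsub-wkΓ ar θ Γ)) (fsub-Bapp θ B S) (⊢-sub (liftSN ar θ) d'))
        (≈f-sub θ h)
  ⊢-sub θ (νE {B = B} {ts = ts} d h) =
    νE (⊢-sub θ d) (≈f-sub-≡ θ h (fsub-unfold θ B ts (fsub-νpred θ B)))

lemma1 : (Sg : Sig) (E : Syntax.Congruence Sg) →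
         ∀ {Δ Δ'} {Γ : List (Syntax.Formula Sg Δ)} {π : Syntax.Pf Sg Δ}
           {P : Syntax.Formula Sg Δ} (θ : Syntax.Sub Sg Δ Δ') →
         Typing._⊢_∶_ Sg E Γ π P →
         Typing._⊢_∶_ Sg E (Syntax.ctxsub Sg θ Γ) (Syntax.pfsub Sg θ π) (Syntax.fsub Sg θ P)
lemma1 Sg E = SubstitutionTyping.⊢-sub Sg E
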